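{- Let $T$ be a $[t]$-unitrade with $\mathrm{afrk}(T)=t+3$ and $\mathrm{vol}(T)=2^{t+1}\pm2^i$, where $t/2\le i\le t-1$. Then $r_j=\mathrm{vol}(T)/2$ for some $j\in\mathrm{found}(T)$.
   Context: Let $V=\{1,\dots,v\}$; subsets of $V$ are identified with characteristic vectors in $\mathrm{GF}(2)^v$. A $[t]$-unitrade is a set $T$ of subsets of $V$ such that every $S\subseteq V$ with $|S|\le t$ is contained in an even number of members of $T$. Its volume is $\mathrm{vol}(T)=|T|/2$; $\mathrm{found}(T)$ is the set of elements of $V$ occurring in some member of $T$; for $\ell\in\mathrm{found}(T)$, $r_\ell=|\{B\in T:\ell\in B\}|/2$; $\mathrm{afrk}(T)$ is the dimension of the affine span of $T$ in $\mathrm{GF}(2)^v$. -}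

module Defs where

open import Data.Nat using (ℕ; zero; suc; _+_; _*_; _∸_; _^_; _≤_; _/_)
open import Data.Nat.Divisibility using (_∣_)
open import Data.Bool using (Bool; true; false; _xor_)
open import Data.Fin using (Fin)
open import Data.Fin.Subset using (Subset; _∈_; _⊆_; ∣_∣; ⊥; Nonempty)
open import Data.Fin.Subset.Properties using (_∈?_; _⊆?_)
open import Data.Vec using (Vec; []; _∷_; zipWith)
open import Data.List using (List; []; _∷_; length; filter; foldr)
open import Data.List.Relation.Unary.Unique.Propositional using (Unique)
open import Data.List.Relation.Unary.Any using (Any)
open import Data.Product using (Σ; _×_; ∃)
open import Relation.Binary.PropositionalEquality using (_≡_; _≢_)

-- V = Fin v ; a subset of V is a characteristic vector in GF(2)^v,
-- i.e. Subset v = Vec Bool v.  A family T of subsets is a duplicate-free list.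

count : ∀ {v} → Subset v → List (Subset v) → ℕ
count S T = length (filter (S ⊆?_) T)

countPt : ∀ {v} → Fin v → List (Subset v) → ℕ
countPt ℓ T = length (filter (ℓ ∈?_) T)

IsUnitrade : ∀ {v} → ℕ → List (Subset v) → Set
IsUnitrade {v} t T = Unique T × (∀ (S : Subset v) → ∣ S ∣ ≤ t → 2 ∣ count S T)

vol : ∀ {v} → List (Subset v) → ℕ
vol T = length T / 2

r : ∀ {v} → Fin v → List (Subset v) → ℕ
r ℓ T = countPt ℓ T / 2

_∈found_ : ∀ {v} → Fin v → List (Subset v) → Set
ℓ ∈found T = Any (ℓ ∈_) T

_⊕_ : ∀ {v} → Subset v → Subset v → Subset v
_⊕_ = zipWith _xor_

sumV : ∀ {v} → List (Subset v) → Subset v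
sumV = foldr _⊕_ ⊥

select : ∀ {A : Set} (L : List A) → Subset (length L) → List A
select []      []            = []
select (x ∷ L) (true  ∷ sel) = x ∷ select L sel
select (x ∷ L) (false ∷ sel) = select L sel

-- a family of points of GF(2)^v is affinely independent iff there is no
-- nontrivial vanishing affine combination, i.e. no nonempty subfamily
-- of even size with zero sum
AffIndep : ∀ {v} → List (Subset v) → Set
AffIndep L = ∀ (sel : Subset (length L)) → Nonempty sel → 2 ∣ ∣ sel ∣ →
             sumV (select L sel) ≢ ⊥

-- afrk(T) = d : dimension of the affine span of T equals d, i.e. the
-- maximum size of an affinely independent subfamily of T is d + 1
HasAfrk : ∀ {v} → List (Subset v) → ℕ → Set
HasAfrk T d =
  (Σ (Subset (length T)) λ sel → AffIndep (select T sel) × ∣ sel ∣ ≡ suc d)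
  × (∀ (sel : Subset (length T)) → AffIndep (select T sel) → ∣ sel ∣ ≤ suc d)

{-# OPTIONS --safe #-}
module Submission where

-- Choose an affinely independent subfamily b₀, …, b_k of T spanning T; then k ≤ t + 3.  Members
-- of T are odd combinations of the b's, so every difference x ⊕ y is one of the 2^k even
-- combinations d, and |T|² = Σ_d |T ∩ (T ⊕ d)|.  If T ⊕ d ≠ T for every nonzero such d, then
-- |T ∩ (T ⊕ d)| ≤ |T| − 2^(t+1): the rest R of T, together with R ⊕ d, is a nonempty
-- [t+1]-unitrade and so has at least 2^(t+2) members.  With n = |T| = 2^(t+2) ± 2^(i+1) the
-- resulting bound n² ≤ n + (2^k − 1)(n − 2^(t+1)) says (n − 2^(t+2))² ≤ 2^(t+1), i.e.
-- 2i + 1 ≤ t.  Hence T = T ⊕ d for some d ≠ 0, and every coordinate j with d_j = 1 lies in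
-- exactly half of the members of T.

open import Defs
open import Data.Bool using (Bool; true; false; not; _∧_; _xor_; if_then_else_; T)
open import Data.Bool.Properties
  using (xor-assoc; xor-comm; xor-same; xor-identityˡ; xor-identityʳ; not-involutive; ∧-zeroʳ;
         not-distribˡ-xor; not-distribʳ-xor; xor-annihilates-not)
import Data.Bool.Properties as Bool
open import Data.Fin using (Fin; zero; suc)
open import Data.Fin.Subset using (Subset; ∣_∣; Nonempty) renaming (⊥ to ∅)
open import Data.Fin.Subset.Properties
  using (∣⊥∣≡0; nonempty?; Empty-unique) renaming (_∈?_ to _∈ₛ?_; _⊆?_ to _⊆ₛ?_)
open import Data.List using (List; []; _∷_; length; map; _++_; filter; filterᵇ)
open import Data.List.Properties using (map-++; map-∘; length-++; length-map; length-filter)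
open import Data.List.Membership.Propositional using (_∈_; _∉_; lose; find)
import Data.List.Membership.DecPropositional as DecMembership
open import Data.List.Membership.Propositional.Properties
  using (∈-filter⁺; ∈-filter⁻; ∈-map⁺; ∈-map⁻; ∈-++⁺ˡ; ∈-++⁺ʳ)
open import Data.List.Relation.Unary.All as All using (All; []; _∷_)
open import Data.List.Relation.Unary.All.Properties using (All¬⇒¬Any; ¬All⇒Any¬)
open import Data.List.Relation.Unary.Any using (here; there; any?)
open import Data.List.Relation.Unary.AllPairs using ([]; _∷_)
open import Data.List.Relation.Unary.Unique.Propositional using (Unique)
import Data.List.Relation.Unary.Unique.Propositional.Properties as Unique
open import Data.Nat using (ℕ; zero; suc; _+_; _*_; _∸_; _^_; _≤_; _<_; _/_; z≤n; s≤s)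
open import Data.Nat.Properties
open import Data.Nat.ListAction using (sum)
open import Data.Nat.ListAction.Properties using (sum-++)
open import Data.Nat.Divisibility using (_∣_; divides; ∣m∣n⇒∣m+n; ∣m+n∣m⇒∣n; ∣⇒≤; ∣-refl)
open import Data.Nat.DivMod using (m*n/n≡m)
open import Data.Nat.Tactic.RingSolver using (solve-∀)
open import Data.Product using (Σ; ∃; _×_; _,_; proj₁; proj₂)
open import Data.Sum using (_⊎_; inj₁; inj₂; [_,_]′)
import Data.Sum as Sum
open import Data.Vec using ([]; _∷_; lookup; tail; _[_]≔_)
import Data.Vec.Base as Vec
open import Data.Vec.Properties
  using (zipWith-assoc; zipWith-comm; zipWith-identityˡ; zipWith-identityʳ; lookup-zipWith;
         []≔-idempotent; []≔-lookup; ≡-dec; ∷-injectiveʳ; []=⇒lookup)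
open import Function using (_∘_; const)
open import Relation.Binary.Definitions using (DecidableEquality)
open import Relation.Nullary using (¬_; Dec; yes; no; does; contradiction; ¬?; T?; map′; _×-dec_)
open import Relation.Unary using (Decidable)
open import Relation.Binary.PropositionalEquality

private variable
  A B : Set
  n : ℕ

∑ : List A → (A → ℕ) → ℕ
∑ xs f = sum (map f xs)

𝟙 : Bool → ℕ
𝟙 b = if b then 1 else 0

∑-cong-∈ : ∀ (xs : List A) {f g : A → ℕ} → (∀ {x} → x ∈ xs → f x ≡ g x) → ∑ xs f ≡ ∑ xs g
∑-cong-∈ []       eq = refl
∑-cong-∈ (x ∷ xs) eq = cong₂ _+_ (eq (here refl)) (∑-cong-∈ xs (eq ∘ there))

∑-cong : ∀ (xs : List A) {f g : A → ℕ} → (∀ x → f x ≡ g x) → ∑ xs f ≡ ∑ xs g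
∑-cong xs eq = ∑-cong-∈ xs (λ {x} _ → eq x)

∑-mono-∈ : ∀ (xs : List A) {f g : A → ℕ} → (∀ {x} → x ∈ xs → f x ≤ g x) → ∑ xs f ≤ ∑ xs g
∑-mono-∈ []       le = z≤n
∑-mono-∈ (x ∷ xs) le = +-mono-≤ (le (here refl)) (∑-mono-∈ xs (le ∘ there))

∑-mono : ∀ (xs : List A) {f g : A → ℕ} → (∀ x → f x ≤ g x) → ∑ xs f ≤ ∑ xs g
∑-mono xs le = ∑-mono-∈ xs (λ {x} _ → le x)

∑-const : ∀ (xs : List A) c → ∑ xs (const c) ≡ length xs * c
∑-const []       c = refl
∑-const (x ∷ xs) c = cong (c +_) (∑-const xs c)

∑-length : ∀ (xs : List A) → ∑ xs (const 1) ≡ length xs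
∑-length []       = refl
∑-length (x ∷ xs) = cong suc (∑-length xs)

∑-distrib-+ : ∀ (xs : List A) {f g : A → ℕ} → ∑ xs (λ x → f x + g x) ≡ ∑ xs f + ∑ xs g
∑-distrib-+ []                   = refl
∑-distrib-+ (x ∷ xs) {f} {g} rewrite ∑-distrib-+ xs {f} {g} =
  +-interchange (f x) (g x) (∑ xs f) (∑ xs g)
  where
  +-interchange : ∀ a b c d → a + b + (c + d) ≡ a + c + (b + d)
  +-interchange = solve-∀

∑-swap : ∀ (xs : List A) (ys : List B) (f : A → B → ℕ) →
         ∑ xs (λ x → ∑ ys (f x)) ≡ ∑ ys (λ y → ∑ xs (λ x → f x y))
∑-swap []       ys f = sym (trans (∑-const ys 0) (*-zeroʳ (length ys)))
∑-swap (x ∷ xs) ys f = trans (cong (∑ ys (f x) +_) (∑-swap xs ys f)) (sym (∑-distrib-+ ys))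

∑-++ : ∀ (xs ys : List A) (f : A → ℕ) → ∑ (xs ++ ys) f ≡ ∑ xs f + ∑ ys f
∑-++ xs ys f = trans (cong sum (map-++ f xs ys)) (sum-++ (map f xs) (map f ys))

∑-map : ∀ (g : A → B) (xs : List A) (f : B → ℕ) → ∑ (map g xs) f ≡ ∑ xs (f ∘ g)
∑-map g xs f = cong sum (sym (map-∘ xs))

∑-filter : ∀ {P : A → Set} (P? : Decidable P) xs (f : A → ℕ) →
           ∑ (filter P? xs) f ≡ ∑ xs (λ x → if does (P? x) then f x else 0)
∑-filter P? []       f = refl
∑-filter P? (x ∷ xs) f with does (P? x)
... | true  = cong (f x +_) (∑-filter P? xs f)
... | false = ∑-filter P? xs f

∑-partition : ∀ {P : A → Set} (P? : Decidable P) xs (f : A → ℕ) →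
              ∑ xs f ≡ ∑ (filter P? xs) f + ∑ (filter (¬? ∘ P?) xs) f
∑-partition P? xs f = begin
  ∑ xs f
    ≡⟨ ∑-cong xs (λ x → sym (split (does (P? x)) (f x))) ⟩
  ∑ xs (λ x → (if does (P? x) then f x else 0) + (if not (does (P? x)) then f x else 0))
    ≡⟨ ∑-distrib-+ xs ⟩
  ∑ xs (λ x → if does (P? x) then f x else 0) + ∑ xs (λ x → if not (does (P? x)) then f x else 0)
    ≡⟨ sym (cong₂ _+_ (∑-filter P? xs f) (∑-filter (¬? ∘ P?) xs f)) ⟩
  ∑ (filter P? xs) f + ∑ (filter (¬? ∘ P?) xs) f
    ∎
  where
  open ≡-Reasoning
  split : ∀ b m → (if b then m else 0) + (if not b then m else 0) ≡ m
  split true  m = +-identityʳ m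
  split false m = refl

length-filter-∑ : ∀ {P : A → Set} (P? : Decidable P) xs →
                  length (filter P? xs) ≡ ∑ xs (𝟙 ∘ does ∘ P?)
length-filter-∑ P? xs = trans (sym (∑-length (filter P? xs))) (∑-filter P? xs (const 1))

length-partition : ∀ {P : A → Set} (P? : Decidable P) xs →
                   length xs ≡ length (filter P? xs) + length (filter (¬? ∘ P?) xs)
length-partition P? xs = begin
  length xs
    ≡⟨ sym (∑-length xs) ⟩
  ∑ xs (const 1)
    ≡⟨ ∑-partition P? xs (const 1) ⟩
  ∑ (filter P? xs) (const 1) + ∑ (filter (¬? ∘ P?) xs) (const 1)
    ≡⟨ cong₂ _+_ (∑-length (filter P? xs)) (∑-length (filter (¬? ∘ P?) xs)) ⟩
  length (filter P? xs) + length (filter (¬? ∘ P?) xs)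
    ∎
  where open ≡-Reasoning

∑-filterᵇ-𝟙 : ∀ (p q : A → Bool) xs →
              ∑ xs (λ x → 𝟙 (p x ∧ q x)) ≡ ∑ (filterᵇ p xs) (𝟙 ∘ q)
∑-filterᵇ-𝟙 p q xs = trans (∑-cong xs (λ x → 𝟙-∧ (p x))) (sym (∑-filter _ xs (𝟙 ∘ q)))
  where
  𝟙-∧ : ∀ b {c} → 𝟙 (b ∧ c) ≡ (if b then 𝟙 c else 0)
  𝟙-∧ true  = refl
  𝟙-∧ false = refl

∑-𝟙-split : ∀ (p q : A → Bool) xs →
             ∑ xs (𝟙 ∘ q) ≡ ∑ (filterᵇ p xs) (𝟙 ∘ q) + ∑ xs (λ x → 𝟙 (not (p x) ∧ q x))
∑-𝟙-split p q xs = begin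
  ∑ xs (𝟙 ∘ q)
    ≡⟨ ∑-cong xs (λ x → split (p x) (q x)) ⟩
  ∑ xs (λ x → 𝟙 (p x ∧ q x) + 𝟙 (not (p x) ∧ q x))
    ≡⟨ ∑-distrib-+ xs ⟩
  ∑ xs (λ x → 𝟙 (p x ∧ q x)) + ∑ xs (λ x → 𝟙 (not (p x) ∧ q x))
    ≡⟨ cong (_+ ∑ xs (λ x → 𝟙 (not (p x) ∧ q x))) (∑-filterᵇ-𝟙 p q xs) ⟩
  ∑ (filterᵇ p xs) (𝟙 ∘ q) + ∑ xs (λ x → 𝟙 (not (p x) ∧ q x))
    ∎
  where
  open ≡-Reasoning
  split : ∀ b c → 𝟙 c ≡ 𝟙 (b ∧ c) + 𝟙 (not b ∧ c)
  split true  c = sym (+-identityʳ (𝟙 c))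
  split false c = refl

module Kronecker {A : Set} (_≟_ : DecidableEquality A) where

  open DecMembership _≟_ using (_∈?_)

  δ : A → A → ℕ → ℕ
  δ x y c = if does (x ≟ y) then c else 0

  ∑-δ-∉ : ∀ {z} xs (f : A → ℕ) → z ∉ xs → ∑ xs (λ y → δ y z (f y)) ≡ 0
  ∑-δ-∉ []           f z∉ = refl
  ∑-δ-∉ {z} (x ∷ xs) f z∉ with x ≟ z
  ... | yes refl = contradiction (here refl) z∉
  ... | no _     = ∑-δ-∉ xs f (z∉ ∘ there)

  ∑-δ-∈ : ∀ {z} xs (f : A → ℕ) → Unique xs → z ∈ xs → ∑ xs (λ y → δ y z (f y)) ≡ f z
  ∑-δ-∈ (x ∷ xs) f (x∉ ∷ _) (here refl) with x ≟ x
  ... | yes _  = trans (cong (f x +_) (∑-δ-∉ xs f (All¬⇒¬Any x∉))) (+-identityʳ (f x))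
  ... | no x≢x = contradiction refl x≢x
  ∑-δ-∈ {z} (x ∷ xs) f (x∉ ∷ u) (there z∈) with x ≟ z
  ... | yes refl = contradiction z∈ (All¬⇒¬Any x∉)
  ... | no _     = ∑-δ-∈ xs f u z∈

  ∑-δ-𝟙 : ∀ z xs → Unique xs → ∑ xs (λ y → δ y z 1) ≡ 𝟙 (does (z ∈? xs))
  ∑-δ-𝟙 z xs u with z ∈? xs
  ... | yes z∈ = ∑-δ-∈ xs (const 1) u z∈
  ... | no  z∉ = ∑-δ-∉ xs (const 1) z∉

  ∑-involution : ∀ xs (σ : A → A) (f : A → ℕ) → Unique xs → (∀ x → σ (σ x) ≡ x) →
                 (∀ {x} → x ∈ xs → σ x ∈ xs) → ∑ xs (f ∘ σ) ≡ ∑ xs f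
  ∑-involution xs σ f u σσ σ∈ = begin
    ∑ xs (f ∘ σ)
      ≡⟨ ∑-cong-∈ xs (λ x∈ → sym (∑-δ-∈ xs f u (σ∈ x∈))) ⟩
    ∑ xs (λ x → ∑ xs (λ y → δ y (σ x) (f y)))
      ≡⟨ ∑-swap xs xs _ ⟩
    ∑ xs (λ y → ∑ xs (λ x → δ y (σ x) (f y)))
      ≡⟨ ∑-cong xs (λ y → ∑-cong xs (δ-flip y)) ⟩
    ∑ xs (λ y → ∑ xs (λ x → δ x (σ y) (f y)))
      ≡⟨ ∑-cong-∈ xs (λ {y} y∈ → ∑-δ-∈ xs (const (f y)) u (σ∈ y∈)) ⟩
    ∑ xs f
      ∎
    where
    open ≡-Reasoning
    δ-flip : ∀ y x → δ y (σ x) (f y) ≡ δ x (σ y) (f y)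
    δ-flip y x with y ≟ σ x | x ≟ σ y
    ... | yes _    | yes _    = refl
    ... | no _     | no _     = refl
    ... | yes refl | no x≢σy  = contradiction (sym (σσ x)) x≢σy
    ... | no y≢σx  | yes refl = contradiction (sym (σσ y)) y≢σx

  -- c is added on both sides to avoid writing (length xs ∸ 1) * c.
  ∑-if-≟ : ∀ {z} xs (a c : ℕ) → Unique xs → z ∈ xs →
           ∑ xs (λ y → if does (y ≟ z) then a else c) + c ≡ a + length xs * c
  ∑-if-≟ {z} xs a c u z∈ = begin
    ∑ xs h + c                             ≡⟨ cong (∑ xs h +_) (sym (∑-δ-∈ xs (const c) u z∈)) ⟩
    ∑ xs h + ∑ xs (λ y → δ y z c)          ≡⟨ sym (∑-distrib-+ xs) ⟩
    ∑ xs (λ y → h y + δ y z c)             ≡⟨ ∑-cong xs (λ y → split (does (y ≟ z))) ⟩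
    ∑ xs (λ y → δ y z a + c)               ≡⟨ ∑-distrib-+ xs ⟩
    ∑ xs (λ y → δ y z a) + ∑ xs (const c)  ≡⟨ cong₂ _+_ (∑-δ-∈ xs (const a) u z∈)
                                                          (∑-const xs c) ⟩
    a + length xs * c                      ∎
    where
    open ≡-Reasoning
    h : A → ℕ
    h y = if does (y ≟ z) then a else c
    split : ∀ b → (if b then a else c) + (if b then c else 0) ≡ (if b then a else 0) + c
    split true  = refl
    split false = +-comm c 0

_≟ᵥ_ : DecidableEquality (Subset n)
_≟ᵥ_ = ≡-dec Bool._≟_

_∈ₗ?_ : ∀ (x : Subset n) L → Dec (x ∈ L)
_∈ₗ?_ = DecMembership._∈?_ _≟ᵥ_

module K {n} = Kronecker (_≟ᵥ_ {n})

⊕-comm : ∀ (x y : Subset n) → x ⊕ y ≡ y ⊕ x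
⊕-comm = zipWith-comm xor-comm

⊕-assoc : ∀ (x y z : Subset n) → (x ⊕ y) ⊕ z ≡ x ⊕ (y ⊕ z)
⊕-assoc = zipWith-assoc xor-assoc

⊕-identityˡ : ∀ (x : Subset n) → ∅ ⊕ x ≡ x
⊕-identityˡ = zipWith-identityˡ xor-identityˡ

⊕-identityʳ : ∀ (x : Subset n) → x ⊕ ∅ ≡ x
⊕-identityʳ = zipWith-identityʳ xor-identityʳ

⊕-self : ∀ (x : Subset n) → x ⊕ x ≡ ∅
⊕-self []      = refl
⊕-self (b ∷ x) = cong₂ _∷_ (xor-same b) (⊕-self x)

⊕-cancelʳ : ∀ (x d : Subset n) → (x ⊕ d) ⊕ d ≡ x
⊕-cancelʳ x d = begin
  (x ⊕ d) ⊕ d  ≡⟨ ⊕-assoc x d d ⟩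
  x ⊕ (d ⊕ d)  ≡⟨ cong (x ⊕_) (⊕-self d) ⟩
  x ⊕ ∅        ≡⟨ ⊕-identityʳ x ⟩
  x            ∎
  where open ≡-Reasoning

⊕-injectiveʳ : ∀ (d : Subset n) {x y} → x ⊕ d ≡ y ⊕ d → x ≡ y
⊕-injectiveʳ d {x} {y} eq = begin
  x            ≡⟨ sym (⊕-cancelʳ x d) ⟩
  (x ⊕ d) ⊕ d  ≡⟨ cong (_⊕ d) eq ⟩
  (y ⊕ d) ⊕ d  ≡⟨ ⊕-cancelʳ y d ⟩
  y            ∎
  where open ≡-Reasoning

⊕≡∅⇒≡ : ∀ {x y : Subset n} → x ⊕ y ≡ ∅ → x ≡ y
⊕≡∅⇒≡ {y = y} eq = ⊕-injectiveʳ y (trans eq (sym (⊕-self y)))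

⊕-interchange : ∀ (a b c d : Subset n) → (a ⊕ b) ⊕ (c ⊕ d) ≡ (a ⊕ c) ⊕ (b ⊕ d)
⊕-interchange a b c d = begin
  (a ⊕ b) ⊕ (c ⊕ d)  ≡⟨ ⊕-assoc a b (c ⊕ d) ⟩
  a ⊕ (b ⊕ (c ⊕ d))  ≡⟨ cong (a ⊕_) (sym (⊕-assoc b c d)) ⟩
  a ⊕ ((b ⊕ c) ⊕ d)  ≡⟨ cong (λ e → a ⊕ (e ⊕ d)) (⊕-comm b c) ⟩
  a ⊕ ((c ⊕ b) ⊕ d)  ≡⟨ cong (a ⊕_) (⊕-assoc c b d) ⟩
  a ⊕ (c ⊕ (b ⊕ d))  ≡⟨ sym (⊕-assoc a c (b ⊕ d)) ⟩
  (a ⊕ c) ⊕ (b ⊕ d)  ∎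
  where open ≡-Reasoning

lookup-⊕ : ∀ (x y : Subset n) j → lookup (x ⊕ y) j ≡ lookup x j xor lookup y j
lookup-⊕ x y j = lookup-zipWith _xor_ j x y

≢∅⇒Nonempty : ∀ (p : Subset n) → p ≢ ∅ → Nonempty p
≢∅⇒Nonempty p p≢∅ with nonempty? p
... | yes ne  = ne
... | no  ¬ne = contradiction (Empty-unique ¬ne) p≢∅

≢⇒lookup≢ : ∀ {x y : Subset n} → x ≢ y → ∃ λ j → lookup x j ≢ lookup y j
≢⇒lookup≢ {x = []}    {[]}    x≢y = contradiction refl x≢y
≢⇒lookup≢ {x = a ∷ x} {b ∷ y} x≢y with a Bool.≟ b
... | no a≢b  = zero , a≢b
... | yes refl with ≢⇒lookup≢ (x≢y ∘ cong (a ∷_))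
...   | j , xⱼ≢yⱼ = suc j , xⱼ≢yⱼ

_⊆ᵇ_ : Subset n → Subset n → Bool
[]          ⊆ᵇ []      = true
(false ∷ p) ⊆ᵇ (_ ∷ q) = p ⊆ᵇ q
(true  ∷ p) ⊆ᵇ (b ∷ q) = b ∧ p ⊆ᵇ q

does-⊆? : ∀ (p q : Subset n) → does (p ⊆ₛ? q) ≡ p ⊆ᵇ q
does-⊆? []          []          = refl
does-⊆? (false ∷ p) (_ ∷ q)     = does-⊆? p q
does-⊆? (true  ∷ p) (false ∷ q) = refl
does-⊆? (true  ∷ p) (true  ∷ q) = does-⊆? p q

does-∈? : ∀ (j : Fin n) (q : Subset n) → does (j ∈ₛ? q) ≡ lookup q j
does-∈? zero    (true  ∷ q) = refl
does-∈? zero    (false ∷ q) = refl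
does-∈? (suc j) (_ ∷ q)     = does-∈? j q

∅-⊆ᵇ : ∀ (y : Subset n) → ∅ ⊆ᵇ y ≡ true
∅-⊆ᵇ []      = refl
∅-⊆ᵇ (_ ∷ y) = ∅-⊆ᵇ y

⊆ᵇ-insert : ∀ (U y : Subset n) s → (U [ s ]≔ true) ⊆ᵇ y ≡ lookup y s ∧ U ⊆ᵇ y
⊆ᵇ-insert (false ∷ U) (b     ∷ y) zero    = refl
⊆ᵇ-insert (true  ∷ U) (true  ∷ y) zero    = refl
⊆ᵇ-insert (true  ∷ U) (false ∷ y) zero    = refl
⊆ᵇ-insert (false ∷ U) (b     ∷ y) (suc s) = ⊆ᵇ-insert U y s
⊆ᵇ-insert (true  ∷ U) (true  ∷ y) (suc s) = ⊆ᵇ-insert U y s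
⊆ᵇ-insert (true  ∷ U) (false ∷ y) (suc s) = sym (∧-zeroʳ (lookup y s))

remove-insert : ∀ (S : Subset n) s → lookup S s ≡ true → (S [ s ]≔ false) [ s ]≔ true ≡ S
remove-insert S s Sₛ = begin
  (S [ s ]≔ false) [ s ]≔ true  ≡⟨ []≔-idempotent S s ⟩
  S [ s ]≔ true                 ≡⟨ cong (S [ s ]≔_) (sym Sₛ) ⟩
  S [ s ]≔ lookup S s           ≡⟨ []≔-lookup S s ⟩
  S                             ∎
  where open ≡-Reasoning

∣∣-insert : ∀ (U : Subset n) s → ∣ U [ s ]≔ true ∣ ≤ suc ∣ U ∣
∣∣-insert (true  ∷ U) zero    = n≤1+n _
∣∣-insert (false ∷ U) zero    = ≤-refl
∣∣-insert (true  ∷ U) (suc s) = s≤s (∣∣-insert U s)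
∣∣-insert (false ∷ U) (suc s) = ∣∣-insert U s

∣∣-remove : ∀ {m} (S : Subset n) → ∣ S ∣ ≡ suc m →
            ∃ λ s → lookup S s ≡ true × ∣ S [ s ]≔ false ∣ ≡ m
∣∣-remove (true  ∷ S) eq = zero , refl , suc-injective eq
∣∣-remove (false ∷ S) eq with ∣∣-remove S eq
... | s , Sₛ , size = suc s , Sₛ , size

∣∣≡0⇒≡∅ : ∀ (S : Subset n) → ∣ S ∣ ≡ 0 → S ≡ ∅
∣∣≡0⇒≡∅ []          _  = refl
∣∣≡0⇒≡∅ (false ∷ S) eq = cong (false ∷_) (∣∣≡0⇒≡∅ S eq)

-- Trades

cov : List (Subset n) → Subset n → ℕ
cov L S = ∑ L (λ x → 𝟙 (S ⊆ᵇ x))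

cov⊕ : List (Subset n) → Subset n → Subset n → ℕ
cov⊕ L d S = ∑ L (λ x → 𝟙 (S ⊆ᵇ (x ⊕ d)))

EvenUpTo : ℕ → List (Subset n) → Set
EvenUpTo {n} t L = ∀ (S : Subset n) → ∣ S ∣ ≤ t → 2 ∣ cov L S

containing avoiding : Fin n → List (Subset n) → List (Subset n)
containing s = filterᵇ (λ x → lookup x s)
avoiding   s = filter (¬? ∘ T? ∘ λ x → lookup x s)

count≡cov : ∀ (S : Subset n) L → count S L ≡ cov L S
count≡cov S L = trans (length-filter-∑ (S ⊆ₛ?_) L) (∑-cong L (λ x → cong 𝟙 (does-⊆? S x)))

cov-∅ : ∀ (L : List (Subset n)) → cov L ∅ ≡ length L
cov-∅ L = trans (∑-cong L (λ x → cong 𝟙 (∅-⊆ᵇ x))) (∑-length L)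

cov⊕-∅ : ∀ (L : List (Subset n)) d → cov⊕ L d ∅ ≡ length L
cov⊕-∅ L d = trans (∑-cong L (λ x → cong 𝟙 (∅-⊆ᵇ (x ⊕ d)))) (∑-length L)

cov-insert : ∀ (L : List (Subset n)) U s → cov L (U [ s ]≔ true) ≡ cov (containing s L) U
cov-insert L U s = trans (∑-cong L (λ x → cong 𝟙 (⊆ᵇ-insert U x s)))
                         (∑-filterᵇ-𝟙 (λ x → lookup x s) (U ⊆ᵇ_) L)

cov-remove : ∀ (L : List (Subset n)) S s → lookup S s ≡ true →
             cov L S ≡ cov (containing s L) (S [ s ]≔ false)
cov-remove L S s Sₛ =
  trans (cong (cov L) (sym (remove-insert S s Sₛ))) (cov-insert L (S [ s ]≔ false) s)

cov⊕-insert : ∀ (L : List (Subset n)) d U s {b} → lookup d s ≡ b →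
              cov⊕ L d (U [ s ]≔ true) ≡ ∑ L (λ x → 𝟙 ((lookup x s xor b) ∧ U ⊆ᵇ (x ⊕ d)))
cov⊕-insert L d U s {b} dₛ = ∑-cong L λ x → cong 𝟙 (begin
  (U [ s ]≔ true) ⊆ᵇ (x ⊕ d)           ≡⟨ ⊆ᵇ-insert U (x ⊕ d) s ⟩
  lookup (x ⊕ d) s ∧ U ⊆ᵇ (x ⊕ d)      ≡⟨ cong (_∧ U ⊆ᵇ (x ⊕ d)) (lookup-⊕ x d s) ⟩
  (lookup x s xor lookup d s) ∧ U ⊆ᵇ (x ⊕ d)
                                       ≡⟨ cong (λ b → (lookup x s xor b) ∧ U ⊆ᵇ (x ⊕ d)) dₛ ⟩
  (lookup x s xor b) ∧ U ⊆ᵇ (x ⊕ d)    ∎)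
  where open ≡-Reasoning

cov⊕-remove-fixed : ∀ (L : List (Subset n)) d S s → lookup S s ≡ true → lookup d s ≡ false →
                    cov⊕ L d S ≡ cov⊕ (containing s L) d (S [ s ]≔ false)
cov⊕-remove-fixed L d S s Sₛ dₛ = begin
  cov⊕ L d S
    ≡⟨ cong (cov⊕ L d) (sym (remove-insert S s Sₛ)) ⟩
  cov⊕ L d (S⁻ [ s ]≔ true)
    ≡⟨ cov⊕-insert L d S⁻ s dₛ ⟩
  ∑ L (λ x → 𝟙 ((lookup x s xor false) ∧ S⁻ ⊆ᵇ (x ⊕ d)))
    ≡⟨ ∑-cong L (λ x → cong (λ b → 𝟙 (b ∧ S⁻ ⊆ᵇ (x ⊕ d))) (xor-identityʳ (lookup x s))) ⟩
  ∑ L (λ x → 𝟙 (lookup x s ∧ S⁻ ⊆ᵇ (x ⊕ d)))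
    ≡⟨ ∑-filterᵇ-𝟙 (λ x → lookup x s) (λ x → S⁻ ⊆ᵇ (x ⊕ d)) L ⟩
  cov⊕ (containing s L) d S⁻
    ∎
  where
  open ≡-Reasoning
  S⁻ = S [ s ]≔ false

cov⊕-remove-flipped : ∀ (L : List (Subset n)) d S s → lookup S s ≡ true → lookup d s ≡ true →
                      cov⊕ L d (S [ s ]≔ false) ≡
                      cov⊕ (containing s L) d (S [ s ]≔ false) + cov⊕ L d S
cov⊕-remove-flipped L d S s Sₛ dₛ = begin
  cov⊕ L d S⁻
    ≡⟨ ∑-𝟙-split (λ x → lookup x s) (λ x → S⁻ ⊆ᵇ (x ⊕ d)) L ⟩
  C + ∑ L (λ x → 𝟙 (not (lookup x s) ∧ S⁻ ⊆ᵇ (x ⊕ d)))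
    ≡⟨ cong (C +_) (∑-cong L λ x → cong (λ b → 𝟙 (b ∧ S⁻ ⊆ᵇ (x ⊕ d)))
                                         (sym (xor-comm (lookup x s) true))) ⟩
  C + ∑ L (λ x → 𝟙 ((lookup x s xor true) ∧ S⁻ ⊆ᵇ (x ⊕ d)))
    ≡⟨ cong (C +_) (sym (cov⊕-insert L d S⁻ s dₛ)) ⟩
  C + cov⊕ L d (S⁻ [ s ]≔ true)
    ≡⟨ cong (λ S′ → C + cov⊕ L d S′) (remove-insert S s Sₛ) ⟩
  C + cov⊕ L d S
    ∎
  where
  open ≡-Reasoning
  S⁻ = S [ s ]≔ false
  C  = cov⊕ (containing s L) d S⁻

m+m≡m*2 : ∀ m → m + m ≡ m * 2
m+m≡m*2 m = trans (cong (m +_) (sym (+-identityʳ m))) (*-comm 2 m)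

2∣m+m : ∀ m → 2 ∣ m + m
2∣m+m m = divides m (m+m≡m*2 m)

2∣-cancel-middle : ∀ {a b c} → 2 ∣ a + b → 2 ∣ b + c → 2 ∣ a + c
2∣-cancel-middle {a} {b} {c} ab bc =
  ∣m+n∣m⇒∣n (subst (2 ∣_) (rearrange a b c) (∣m∣n⇒∣m+n ab bc)) (2∣m+m b)
  where
  rearrange : ∀ a b c → (a + b) + (b + c) ≡ (b + b) + (a + c)
  rearrange = solve-∀

-- Remove a point s
-- from S: if d_s = 0 the translation preserves the members through s, if d_s = 1 it swaps
-- them with the others.
cov+cov⊕-even : ∀ m (L : List (Subset n)) d S → ∣ S ∣ ≡ m →
                (∀ U → ∣ U ∣ < m → 2 ∣ cov L U) → 2 ∣ cov L S + cov⊕ L d S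
cov+cov⊕-even zero L d S size _
  rewrite ∣∣≡0⇒≡∅ S size | cov-∅ L | cov⊕-∅ L d = 2∣m+m (length L)
cov+cov⊕-even (suc m) L d S size even with ∣∣-remove S size
... | s , Sₛ , size⁻ = by-direction (lookup d s) refl
  where
  S⁻ = S [ s ]≔ false
  Lₛ = containing s L

  IHₛ : 2 ∣ cov Lₛ S⁻ + cov⊕ Lₛ d S⁻
  IHₛ = cov+cov⊕-even m Lₛ d S⁻ size⁻ λ U lt →
    subst (2 ∣_) (cov-insert L U s) (even (U [ s ]≔ true) (≤-<-trans (∣∣-insert U s) (s≤s lt)))

  by-direction : ∀ b → lookup d s ≡ b → 2 ∣ cov L S + cov⊕ L d S
  by-direction false dₛ =
    subst (2 ∣_) (sym (cong₂ _+_ (cov-remove L S s Sₛ) (cov⊕-remove-fixed L d S s Sₛ dₛ))) IHₛ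
  by-direction true  dₛ =
    subst (λ a → 2 ∣ a + cov⊕ L d S) (sym (cov-remove L S s Sₛ))
          (2∣-cancel-middle {b = cov⊕ Lₛ d S⁻} IHₛ
                            (subst (2 ∣_) (cov⊕-remove-flipped L d S s Sₛ dₛ) 2∣cov⊕⁻))
    where
    IH : 2 ∣ cov L S⁻ + cov⊕ L d S⁻
    IH = cov+cov⊕-even m L d S⁻ size⁻ (λ U lt → even U (m≤n⇒m≤1+n lt))
    2∣cov⊕⁻ : 2 ∣ cov⊕ L d S⁻
    2∣cov⊕⁻ = ∣m+n∣m⇒∣n IH (even S⁻ (≤-reflexive (cong suc size⁻)))

EvenUpTo⇒cov+cov⊕-even : ∀ {t} (L : List (Subset n)) → EvenUpTo t L →
                         ∀ d S → ∣ S ∣ ≤ suc t → 2 ∣ cov L S + cov⊕ L d S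
EvenUpTo⇒cov+cov⊕-even L even d S size =
  cov+cov⊕-even ∣ S ∣ L d S refl (λ U lt → even U (≤-pred (≤-trans lt size)))

2∣length : ∀ {t} (L : List (Subset n)) → EvenUpTo t L → 2 ∣ length L
2∣length {n} {t} L even = subst (2 ∣_) (cov-∅ L) (even ∅ (subst (_≤ t) (sym (∣⊥∣≡0 n)) z≤n))

2≤length : ∀ {t} {x : Subset n} L → EvenUpTo t L → x ∈ L → 2 ≤ length L
2≤length L@(_ ∷ _) even _ = ∣⇒≤ (2∣length L even)

EvenUpTo-containing : ∀ {t} (L : List (Subset n)) s →
                      EvenUpTo (suc t) L → EvenUpTo t (containing s L)
EvenUpTo-containing L s even U size =
  subst (2 ∣_) (cov-insert L U s) (even (U [ s ]≔ true) (≤-trans (∣∣-insert U s) (s≤s size)))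

EvenUpTo-avoiding : ∀ {t} (L : List (Subset n)) s → EvenUpTo (suc t) L → EvenUpTo t (avoiding s L)
EvenUpTo-avoiding L s even U size =
  ∣m+n∣m⇒∣n (subst (2 ∣_) (∑-partition (T? ∘ λ x → lookup x s) L (λ x → 𝟙 (U ⊆ᵇ x)))
                          (even U (m≤n⇒m≤1+n size)))
            (EvenUpTo-containing L s even U size)

∈-containing : ∀ {x : Subset n} L j → x ∈ L → lookup x j ≡ true → x ∈ containing j L
∈-containing _ j x∈ xⱼ = ∈-filter⁺ (T? ∘ λ z → lookup z j) x∈ (subst T (sym xⱼ) _)

∈-avoiding : ∀ {x : Subset n} L j → x ∈ L → lookup x j ≡ false → x ∈ avoiding j L
∈-avoiding _ j x∈ xⱼ = ∈-filter⁺ (¬? ∘ T? ∘ λ z → lookup z j) x∈ (subst T xⱼ)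

separating-coordinate : ∀ (L : List (Subset n)) → Unique L → 2 ≤ length L →
                        ∃ λ j → (∃ λ x → x ∈ containing j L) × (∃ λ y → y ∈ avoiding j L)
separating-coordinate (_ ∷ []) _ (s≤s ())
separating-coordinate L@(x ∷ y ∷ _) ((x≢y ∷ _) ∷ _) _ with ≢⇒lookup≢ x≢y
... | j , xⱼ≢yⱼ with lookup x j in xⱼ | lookup y j in yⱼ
...   | true  | true  = contradiction refl xⱼ≢yⱼ
...   | false | false = contradiction refl xⱼ≢yⱼ
...   | true  | false = j , (x , ∈-containing L j x∈ xⱼ) , (y , ∈-avoiding L j y∈ yⱼ)
  where x∈ = here refl; y∈ = there (here refl)
...   | false | true  = j , (y , ∈-containing L j y∈ yⱼ) , (x , ∈-avoiding L j x∈ xⱼ)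
  where x∈ = here refl; y∈ = there (here refl)

2^-double : ∀ k → 2 ^ suc k ≡ 2 ^ k + 2 ^ k
2^-double k = cong (2 ^ k +_) (+-identityʳ (2 ^ k))

length≥2^ : ∀ t (L : List (Subset n)) → Unique L → EvenUpTo t L → ∀ {x} → x ∈ L →
            2 ^ suc t ≤ length L
length≥2^ zero    L u even x∈ = 2≤length L even x∈
length≥2^ (suc t) L u even x∈ with separating-coordinate L u (2≤length L even x∈)
... | j , (_ , x∈₁) , (_ , y∈₀) = begin
  2 ^ suc (suc t)
    ≡⟨ 2^-double (suc t) ⟩
  2 ^ suc t + 2 ^ suc t
    ≤⟨ +-mono-≤ (length≥2^ t L₁ (Unique.filter⁺ _ u) (EvenUpTo-containing L j even) x∈₁)
                (length≥2^ t L₀ (Unique.filter⁺ _ u) (EvenUpTo-avoiding L j even) y∈₀) ⟩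
  length L₁ + length L₀
    ≡⟨ sym (length-partition (T? ∘ λ x → lookup x j) L) ⟩
  length L
    ∎
  where
  open ≤-Reasoning
  L₁ = containing j L
  L₀ = avoiding j L

ClosedUnder : List (Subset n) → Subset n → Set
ClosedUnder T d = All (λ x → x ⊕ d ∈ T) T

shiftOverlap : List (Subset n) → Subset n → ℕ
shiftOverlap T d = length (filter (λ x → (x ⊕ d) ∈ₗ? T) T)

-- M = T ∩ (T ⊕ d) is invariant under ⊕ d, so by cov+cov⊕-even the rest R of T together
-- with R ⊕ d is even one level higher than T.
module TranslationDefect (T : List (Subset n)) (u : Unique T) (d : Subset n) where

  shifted∈? : ∀ x → Dec (x ⊕ d ∈ T)
  shifted∈? x = (x ⊕ d) ∈ₗ? T

  M R G : List (Subset n)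
  M = filter shifted∈? T
  R = filter (¬? ∘ shifted∈?) T
  G = R ++ map (_⊕ d) R

  M-closed : ∀ {x} → x ∈ M → x ⊕ d ∈ M
  M-closed {x} x∈ with ∈-filter⁻ shifted∈? x∈
  ... | x∈T , x⊕d∈T = ∈-filter⁺ shifted∈? x⊕d∈T (subst (_∈ T) (sym (⊕-cancelʳ x d)) x∈T)

  R-unique : Unique R
  R-unique = Unique.filter⁺ (¬? ∘ shifted∈?) {T} u

  G-unique : Unique G
  G-unique = Unique.++⁺ R-unique (Unique.map⁺ (⊕-injectiveʳ d) R-unique) disjoint
    where
    R⇒ : ∀ {z} → z ∈ R → z ∈ T × z ⊕ d ∉ T
    R⇒ = ∈-filter⁻ (¬? ∘ shifted∈?) {xs = T}
    disjoint : ∀ {z} → ¬ (z ∈ R × z ∈ map (_⊕ d) R)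
    disjoint (z∈R , z∈R⊕d) with ∈-map⁻ (_⊕ d) z∈R⊕d
    ... | y , y∈R , refl =
      proj₂ (R⇒ z∈R) (subst (_∈ T) (sym (⊕-cancelʳ y d)) (proj₁ (R⇒ y∈R)))

  G-even : ∀ {t} → EvenUpTo t T → EvenUpTo (suc t) G
  G-even even S size =
    subst (2 ∣_) (sym cov-G)
          (∣m+n∣m⇒∣n (subst (2 ∣_) cov-T (EvenUpTo⇒cov+cov⊕-even T even d S size))
                     (2∣m+m (cov M S)))
    where
    cov⊕-M : cov⊕ M d S ≡ cov M S
    cov⊕-M = K.∑-involution M (_⊕ d) (λ x → 𝟙 (S ⊆ᵇ x)) (Unique.filter⁺ shifted∈? {T} u)
                            (λ x → ⊕-cancelʳ x d) M-closed
    cov-T : cov T S + cov⊕ T d S ≡ (cov M S + cov M S) + (cov R S + cov⊕ R d S)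
    cov-T = begin
      cov T S + cov⊕ T d S
        ≡⟨ cong₂ _+_ (∑-partition shifted∈? T _) (∑-partition shifted∈? T _) ⟩
      (cov M S + cov R S) + (cov⊕ M d S + cov⊕ R d S)
        ≡⟨ cong (λ m → (cov M S + cov R S) + (m + cov⊕ R d S)) cov⊕-M ⟩
      (cov M S + cov R S) + (cov M S + cov⊕ R d S)
        ≡⟨ +-interchange (cov M S) (cov R S) (cov M S) (cov⊕ R d S) ⟩
      (cov M S + cov M S) + (cov R S + cov⊕ R d S)
        ∎
      where
      open ≡-Reasoning
      +-interchange : ∀ a b c e → (a + b) + (c + e) ≡ (a + c) + (b + e)
      +-interchange = solve-∀
    cov-G : cov G S ≡ cov R S + cov⊕ R d S
    cov-G = trans (∑-++ R (map (_⊕ d) R) _) (cong (cov R S +_) (∑-map (_⊕ d) R _))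

  shiftOverlap-bound : ∀ t → EvenUpTo t T → ∀ {x₀} → x₀ ∈ T → x₀ ⊕ d ∉ T →
                       shiftOverlap T d + 2 ^ suc t ≤ length T
  shiftOverlap-bound t even {x₀} x₀∈ x₀⊕d∉ = begin
    length M + 2 ^ suc t   ≤⟨ +-monoʳ-≤ (length M) 2^≤R ⟩
    length M + length R    ≡⟨ sym (length-partition shifted∈? T) ⟩
    length T               ∎
    where
    open ≤-Reasoning
    x₀∈G : x₀ ∈ G
    x₀∈G = ∈-++⁺ˡ (∈-filter⁺ (¬? ∘ shifted∈?) x₀∈ x₀⊕d∉)
    length-G : length G ≡ 2 * length R
    length-G = trans (length-++ R)
                     (cong (length R +_) (trans (length-map (_⊕ d) R) (sym (+-identityʳ _))))
    2^≤R : 2 ^ suc t ≤ length R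
    2^≤R = *-cancelˡ-≤ 2 (subst (2 ^ suc (suc t) ≤_) length-G
                                (length≥2^ (suc t) G G-unique (G-even even) x₀∈G))

-- Affine spans

parity : Subset n → Bool
parity []      = false
parity (b ∷ s) = b xor parity s

oddᵇ : ℕ → Bool
oddᵇ zero    = false
oddᵇ (suc m) = not (oddᵇ m)

parity≡oddᵇ∣∣ : ∀ (s : Subset n) → parity s ≡ oddᵇ ∣ s ∣
parity≡oddᵇ∣∣ []          = refl
parity≡oddᵇ∣∣ (true  ∷ s) = cong not (parity≡oddᵇ∣∣ s)
parity≡oddᵇ∣∣ (false ∷ s) = parity≡oddᵇ∣∣ s

oddᵇ≡false⇒2∣ : ∀ m → oddᵇ m ≡ false → 2 ∣ m
oddᵇ≡false⇒2∣ zero          _  = divides 0 refl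
oddᵇ≡false⇒2∣ (suc zero)    ()
oddᵇ≡false⇒2∣ (suc (suc m)) eq = subst (2 ∣_) (+-comm m 2)
  (∣m∣n⇒∣m+n (oddᵇ≡false⇒2∣ m (trans (sym (not-involutive _)) eq)) ∣-refl)

2∣⇒oddᵇ≡false : ∀ m → 2 ∣ m → oddᵇ m ≡ false
2∣⇒oddᵇ≡false zero          _   = refl
2∣⇒oddᵇ≡false (suc zero)    2∣1 = contradiction (∣⇒≤ 2∣1) λ { (s≤s ()) }
2∣⇒oddᵇ≡false (suc (suc m)) 2∣m =
  trans (not-involutive _) (2∣⇒oddᵇ≡false m (∣m+n∣m⇒∣n {m = 2} 2∣m ∣-refl))

parity≡false⇒2∣ : ∀ (s : Subset n) → parity s ≡ false → 2 ∣ ∣ s ∣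
parity≡false⇒2∣ s eq = oddᵇ≡false⇒2∣ ∣ s ∣ (trans (sym (parity≡oddᵇ∣∣ s)) eq)

2∣suc⇒parity≡true : ∀ (s : Subset n) → 2 ∣ suc (∣ s ∣) → parity s ≡ true
2∣suc⇒parity≡true s even = begin
  parity s                ≡⟨ parity≡oddᵇ∣∣ s ⟩
  oddᵇ ∣ s ∣              ≡⟨ sym (not-involutive _) ⟩
  not (oddᵇ (suc ∣ s ∣))  ≡⟨ cong not (2∣⇒oddᵇ≡false (suc ∣ s ∣) even) ⟩
  true                    ∎
  where open ≡-Reasoning

parity≡false⇒head : ∀ (s : Subset (suc n)) → parity s ≡ false → s ≡ parity (tail s) ∷ tail s
parity≡false⇒head (true  ∷ s) eq = cong (_∷ s) (sym (trans (sym (not-involutive _)) (cong not eq)))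
parity≡false⇒head (false ∷ s) eq = cong (_∷ s) (sym eq)

xor-interchange : ∀ a b c d → (a xor b) xor (c xor d) ≡ (a xor c) xor (b xor d)
xor-interchange false false c d = refl
xor-interchange true  false c d = not-distribˡ-xor c d
xor-interchange false true  c d = not-distribʳ-xor c d
xor-interchange true  true  c d = sym (xor-annihilates-not c d)

parity-⊕ : ∀ (s s′ : Subset n) → parity (s ⊕ s′) ≡ parity s xor parity s′
parity-⊕ []      []        = refl
parity-⊕ (a ∷ s) (b ∷ s′) =
  trans (cong ((a xor b) xor_) (parity-⊕ s s′)) (xor-interchange a b (parity s) (parity s′))

parity-∅ : ∀ n → parity (∅ {n}) ≡ false
parity-∅ zero    = refl
parity-∅ (suc n) = parity-∅ n

select-∅ : ∀ (L : List A) → select L ∅ ≡ []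
select-∅ []      = refl
select-∅ (_ ∷ L) = select-∅ L

length-select : ∀ (L : List A) sel → length (select L sel) ≡ ∣ sel ∣
length-select []      []            = refl
length-select (_ ∷ L) (true  ∷ sel) = cong suc (length-select L sel)
length-select (_ ∷ L) (false ∷ sel) = length-select L sel

sumV-select-⊕ : ∀ (B : List (Subset n)) s s′ →
                sumV (select B (s ⊕ s′)) ≡ sumV (select B s) ⊕ sumV (select B s′)
sumV-select-⊕ []      []          []           = sym (⊕-self ∅)
sumV-select-⊕ (b ∷ B) (false ∷ s) (false ∷ s′) = sumV-select-⊕ B s s′
sumV-select-⊕ (b ∷ B) (true  ∷ s) (false ∷ s′) =
  trans (cong (b ⊕_) (sumV-select-⊕ B s s′)) (sym (⊕-assoc b _ _))
sumV-select-⊕ (b ∷ B) (false ∷ s) (true  ∷ s′) = begin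
  b ⊕ sumV (select B (s ⊕ s′))  ≡⟨ cong (b ⊕_) (sumV-select-⊕ B s s′) ⟩
  b ⊕ (X ⊕ Y)                   ≡⟨ sym (⊕-assoc b X Y) ⟩
  (b ⊕ X) ⊕ Y                   ≡⟨ cong (_⊕ Y) (⊕-comm b X) ⟩
  (X ⊕ b) ⊕ Y                   ≡⟨ ⊕-assoc X b Y ⟩
  X ⊕ (b ⊕ Y)                   ∎
  where
  open ≡-Reasoning
  X = sumV (select B s)
  Y = sumV (select B s′)
sumV-select-⊕ (b ∷ B) (true  ∷ s) (true  ∷ s′) = begin
  sumV (select B (s ⊕ s′))  ≡⟨ sumV-select-⊕ B s s′ ⟩
  X ⊕ Y                     ≡⟨ sym (⊕-identityˡ (X ⊕ Y)) ⟩
  ∅ ⊕ (X ⊕ Y)               ≡⟨ cong (_⊕ (X ⊕ Y)) (sym (⊕-self b)) ⟩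
  (b ⊕ b) ⊕ (X ⊕ Y)         ≡⟨ ⊕-interchange b b X Y ⟩
  (b ⊕ X) ⊕ (b ⊕ Y)         ∎
  where
  open ≡-Reasoning
  X = sumV (select B s)
  Y = sumV (select B s′)

subsets : ∀ n → List (Subset n)
subsets zero    = [] ∷ []
subsets (suc n) = map (true ∷_) (subsets n) ++ map (false ∷_) (subsets n)

∈-subsets : ∀ (s : Subset n) → s ∈ subsets n
∈-subsets []          = here refl
∈-subsets (true  ∷ s) = ∈-++⁺ˡ (∈-map⁺ (true ∷_) (∈-subsets s))
∈-subsets (false ∷ s) = ∈-++⁺ʳ (map (true ∷_) (subsets _)) (∈-map⁺ (false ∷_) (∈-subsets s))

subsets-unique : ∀ n → Unique (subsets n)
subsets-unique zero    = [] ∷ []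
subsets-unique (suc n) = Unique.++⁺ (Unique.map⁺ ∷-injectiveʳ (subsets-unique n))
                                    (Unique.map⁺ ∷-injectiveʳ (subsets-unique n)) disjoint
  where
  disjoint : ∀ {z} → ¬ (z ∈ map (true ∷_) (subsets n) × z ∈ map (false ∷_) (subsets n))
  disjoint (z∈₁ , z∈₀) with ∈-map⁻ (true ∷_) z∈₁ | ∈-map⁻ (false ∷_) z∈₀
  ... | _ , _ , refl | _ , _ , ()

length-subsets : ∀ n → length (subsets n) ≡ 2 ^ n
length-subsets zero    = refl
length-subsets (suc n) = begin
  length (map (true ∷_) (subsets n) ++ map (false ∷_) (subsets n))
    ≡⟨ length-++ (map (true ∷_) (subsets n)) ⟩
  length (map (true ∷_) (subsets n)) + length (map (false ∷_) (subsets n))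
    ≡⟨ cong₂ _+_ (length-map (true ∷_) (subsets n)) (length-map (false ∷_) (subsets n)) ⟩
  length (subsets n) + length (subsets n)
    ≡⟨ cong₂ _+_ (length-subsets n) (length-subsets n) ⟩
  2 ^ n + 2 ^ n
    ≡⟨ sym (2^-double n) ⟩
  2 ^ suc n
    ∎
  where open ≡-Reasoning

∃-subset? : ∀ {P : Subset n → Set} → Decidable P → Dec (∃ P)
∃-subset? {n} P? = map′ (λ any → let _ , _ , p = find any in _ , p)
                        (λ (s , p) → lose (∈-subsets s) p)
                        (any? P? (subsets n))

InSpan : List (Subset n) → Subset n → Set
InSpan B x = ∃ λ s → parity s ≡ true × sumV (select B s) ≡ x

inSpan? : ∀ (B : List (Subset n)) → Decidable (InSpan B)
inSpan? B x = ∃-subset? (λ s → (parity s Bool.≟ true) ×-dec (sumV (select B s) ≟ᵥ x))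

InSpan-∷ : ∀ {x y} (B : List (Subset n)) → InSpan B y → InSpan (x ∷ B) y
InSpan-∷ B (s , odd , sum≡y) = false ∷ s , odd , sum≡y

InSpan-head : ∀ x (B : List (Subset n)) → InSpan (x ∷ B) x
InSpan-head x B = true ∷ ∅ , cong not (parity-∅ (length B)) ,
                  trans (cong (λ L → x ⊕ sumV L) (select-∅ B)) (⊕-identityʳ x)

AffIndep-∷ : ∀ {x} (B : List (Subset n)) → AffIndep B → ¬ InSpan B x → AffIndep (x ∷ B)
AffIndep-∷ B indep x∉ (false ∷ sel) (suc i , Vec.there i∈) even = indep sel (i , i∈) even
AffIndep-∷ B indep x∉ (true  ∷ sel) _                     even sum≡∅ =
  x∉ (sel , 2∣suc⇒parity≡true sel even , sym (⊕≡∅⇒≡ sum≡∅))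

affine-basis : ∀ (L : List (Subset n)) →
               ∃ λ sel → AffIndep (select L sel) × All (InSpan (select L sel)) L
affine-basis []      = [] , (λ { [] (() , _) }) , []
affine-basis (x ∷ L) with affine-basis L
... | sel , indep , spans with inSpan? (select L sel) x
...   | yes x∈ = false ∷ sel , indep , x∈ ∷ spans
...   | no  x∉ = true ∷ sel , AffIndep-∷ (select L sel) indep x∉ ,
                 InSpan-head x (select L sel) ∷ All.map (InSpan-∷ (select L sel)) spans

-- Counting pairs by difference

PairBound : ℕ → ℕ → List (Subset n) → Set
PairBound t r T = N * N + (N ∸ 2 ^ suc t) ≤ N + 2 ^ r * (N ∸ 2 ^ suc t)
  where N = length T

-- Members of T have odd-weight coefficient vectors over the basis b₀ ∷ B, so the coefficient
-- vector of a difference has even weight and is determined by its last k = length B entries: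
-- y = x ⊕ shift (code x y).
module DifferenceCounting (t : ℕ) (T : List (Subset n)) (u : Unique T) (even : EvenUpTo t T)
                          (b₀ : Subset n) (B : List (Subset n))
                          (indep : AffIndep (b₀ ∷ B)) (spans : All (InSpan (b₀ ∷ B)) T) where

  k : ℕ
  k = length B

  coeffs : Subset n → Subset (suc k)
  coeffs x with inSpan? (b₀ ∷ B) x
  ... | yes (s , _) = s
  ... | no  _       = ∅

  coeffs-spec : ∀ {x} → InSpan (b₀ ∷ B) x →
                parity (coeffs x) ≡ true × sumV (select (b₀ ∷ B) (coeffs x)) ≡ x
  coeffs-spec {x} x∈ with inSpan? (b₀ ∷ B) x
  ... | yes (_ , odd , sum≡x) = odd , sum≡x
  ... | no  x∉                = contradiction x∈ x∉

  shift : Subset k → Subset n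
  shift δ = sumV (select (b₀ ∷ B) (parity δ ∷ δ))

  code : Subset n → Subset n → Subset k
  code x y = tail (coeffs x ⊕ coeffs y)

  shift-code : ∀ {x y} → x ∈ T → y ∈ T → y ≡ x ⊕ shift (code x y)
  shift-code {x} {y} x∈ y∈ = begin
    y                              ≡⟨ sym (⊕-identityˡ y) ⟩
    ∅ ⊕ y                          ≡⟨ cong (_⊕ y) (sym (⊕-self x)) ⟩
    (x ⊕ x) ⊕ y                    ≡⟨ ⊕-assoc x x y ⟩
    x ⊕ (x ⊕ y)                    ≡⟨ cong (x ⊕_) (sym sum-K) ⟩
    x ⊕ sumV (select (b₀ ∷ B) K)   ≡⟨ cong (λ s → x ⊕ sumV (select (b₀ ∷ B) s)) K≡ ⟩
    x ⊕ shift (code x y)           ∎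
    where
    open ≡-Reasoning
    cx = coeffs-spec (All.lookup spans x∈)
    cy = coeffs-spec (All.lookup spans y∈)
    K = coeffs x ⊕ coeffs y
    sum-K : sumV (select (b₀ ∷ B) K) ≡ x ⊕ y
    sum-K = trans (sumV-select-⊕ (b₀ ∷ B) (coeffs x) (coeffs y))
                  (cong₂ _⊕_ (proj₂ cx) (proj₂ cy))
    K≡ : K ≡ parity (tail K) ∷ tail K
    K≡ = parity≡false⇒head K
           (trans (parity-⊕ (coeffs x) (coeffs y)) (cong₂ _xor_ (proj₁ cx) (proj₁ cy)))

  shift-nonzero : ∀ δ → δ ≢ ∅ → shift δ ≢ ∅
  shift-nonzero δ δ≢∅ =
    indep (parity δ ∷ δ) nonempty (parity≡false⇒2∣ (parity δ ∷ δ) (xor-same (parity δ)))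
    where
    nonempty : Nonempty (parity δ ∷ δ)
    nonempty with ≢∅⇒Nonempty δ δ≢∅
    ... | i , i∈δ = suc i , Vec.there i∈δ

  fibre-bound : ∀ δ {x} → x ∈ T →
                ∑ T (λ y → K.δ δ (code x y) 1) ≤ 𝟙 (does ((x ⊕ shift δ) ∈ₗ? T))
  fibre-bound δ {x} x∈ = begin
    ∑ T (λ y → K.δ δ (code x y) 1)     ≤⟨ ∑-mono-∈ T pointwise ⟩
    ∑ T (λ y → K.δ y (x ⊕ shift δ) 1)  ≡⟨ K.∑-δ-𝟙 (x ⊕ shift δ) T u ⟩
    𝟙 (does ((x ⊕ shift δ) ∈ₗ? T))     ∎
    where
    open ≤-Reasoning
    pointwise : ∀ {y} → y ∈ T → K.δ δ (code x y) 1 ≤ K.δ y (x ⊕ shift δ) 1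
    pointwise {y} y∈ with δ ≟ᵥ code x y
    ... | no _     = z≤n
    ... | yes refl with y ≟ᵥ (x ⊕ shift (code x y))
    ...   | yes _  = ≤-refl
    ...   | no y≢  = contradiction (shift-code x∈ y∈) y≢

  pairs-bound : length T * length T ≤ ∑ (subsets k) (λ δ → shiftOverlap T (shift δ))
  pairs-bound = begin
    length T * length T
      ≡⟨ sym (∑-const T (length T)) ⟩
    ∑ T (λ x → length T)
      ≡⟨ ∑-cong T (λ x → sym (∑-length T)) ⟩
    ∑ T (λ x → ∑ T (λ y → 1))
      ≡⟨ ∑-cong T (λ x → ∑-cong T (λ y → sym (K.∑-δ-∈ (subsets k) (const 1) (subsets-unique k)
                                                                   (∈-subsets (code x y))))) ⟩
    ∑ T (λ x → ∑ T (λ y → ∑ (subsets k) (λ δ → K.δ δ (code x y) 1)))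
      ≡⟨ ∑-cong T (λ x → ∑-swap T (subsets k) _) ⟩
    ∑ T (λ x → ∑ (subsets k) (λ δ → ∑ T (λ y → K.δ δ (code x y) 1)))
      ≤⟨ ∑-mono-∈ T (λ x∈ → ∑-mono (subsets k) (λ δ → fibre-bound δ x∈)) ⟩
    ∑ T (λ x → ∑ (subsets k) (λ δ → 𝟙 (does ((x ⊕ shift δ) ∈ₗ? T))))
      ≡⟨ ∑-swap T (subsets k) _ ⟩
    ∑ (subsets k) (λ δ → ∑ T (λ x → 𝟙 (does ((x ⊕ shift δ) ∈ₗ? T))))
      ≡⟨ ∑-cong (subsets k) (λ δ → sym (length-filter-∑ (λ x → (x ⊕ shift δ) ∈ₗ? T) T)) ⟩
    ∑ (subsets k) (λ δ → shiftOverlap T (shift δ))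
      ∎
    where open ≤-Reasoning

  closed-or-bound : (∃ λ d → d ≢ ∅ × ClosedUnder T d) ⊎ PairBound t k T
  closed-or-bound
    with ∃-subset? (λ δ → ¬? (δ ≟ᵥ ∅) ×-dec All.all? (λ x → (x ⊕ shift δ) ∈ₗ? T) T)
  ... | yes (δ , δ≢∅ , closed) = inj₁ (shift δ , shift-nonzero δ δ≢∅ , closed)
  ... | no  none               = inj₂ (begin
    N * N + c
      ≤⟨ +-monoˡ-≤ c pairs-bound ⟩
    ∑ (subsets k) (λ δ → shiftOverlap T (shift δ)) + c
      ≤⟨ +-monoˡ-≤ c (∑-mono (subsets k) overlap≤) ⟩
    ∑ (subsets k) (λ δ → if does (δ ≟ᵥ ∅) then N else c) + c
      ≡⟨ K.∑-if-≟ (subsets k) N c (subsets-unique k) (∈-subsets ∅) ⟩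
    N + length (subsets k) * c
      ≡⟨ cong (λ m → N + m * c) (length-subsets k) ⟩
    N + 2 ^ k * c
      ∎)
    where
    open ≤-Reasoning
    N = length T
    c = N ∸ 2 ^ suc t
    overlap≤ : ∀ δ → shiftOverlap T (shift δ) ≤ (if does (δ ≟ᵥ ∅) then N else c)
    overlap≤ δ with δ ≟ᵥ ∅
    ... | yes _   = length-filter _ T
    ... | no δ≢∅
      with find (¬All⇒Any¬ (λ x → (x ⊕ shift δ) ∈ₗ? T) T (λ closed → none (δ , δ≢∅ , closed)))
    ...   | x₀ , x₀∈ , x₀⊕d∉ =
      m+n≤o⇒m≤o∸n _ (TranslationDefect.shiftOverlap-bound T u (shift δ) t even x₀∈ x₀⊕d∉)

translation-or-bound : ∀ t r (T : List (Subset n)) → Unique T → EvenUpTo t T →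
                       (∀ sel → AffIndep (select T sel) → ∣ sel ∣ ≤ suc r) →
                       (∃ λ d → d ≢ ∅ × ClosedUnder T d) ⊎ PairBound t r T
translation-or-bound t r []          _ _    _     rewrite 0∸n≡0 (2 ^ suc t) = inj₂ z≤n
translation-or-bound t r T@(_ ∷ _) u even rank≤ with affine-basis T
... | sel , indep , spans =
  from-basis (select T sel) indep spans
             (subst (_≤ suc r) (sym (length-select T sel)) (rank≤ sel indep))
  where
  from-basis : ∀ Bs → AffIndep Bs → All (InSpan Bs) T → length Bs ≤ suc r →
               (∃ λ d → d ≢ ∅ × ClosedUnder T d) ⊎ PairBound t r T
  from-basis []       _     (([] , () , _) ∷ _) _
  from-basis (b₀ ∷ B) indep spans (s≤s k≤r)
    with DifferenceCounting.closed-or-bound t T u even b₀ B indep spans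
  ... | inj₁ closed = inj₁ closed
  ... | inj₂ bound  =
    inj₂ (≤-trans bound (+-monoʳ-≤ (length T) (*-monoˡ-≤ _ (^-monoʳ-≤ 2 k≤r))))

-- A translation-invariant family

countPt≡∑ : ∀ (j : Fin n) T → countPt j T ≡ ∑ T (λ x → 𝟙 (lookup x j))
countPt≡∑ j T = trans (length-filter-∑ (j ∈ₛ?_) T) (∑-cong T (λ x → cong 𝟙 (does-∈? j x)))

countPt-closed : ∀ (T : List (Subset n)) d j → Unique T → ClosedUnder T d → lookup d j ≡ true →
                 countPt j T + countPt j T ≡ length T
countPt-closed T d j u closed dⱼ = begin
  countPt j T + countPt j T
    ≡⟨ cong₂ _+_ (trans (countPt≡∑ j T) (sym translated)) (countPt≡∑ j T) ⟩
  ∑ T (λ x → 𝟙 (lookup (x ⊕ d) j)) + ∑ T (λ x → 𝟙 (lookup x j))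
    ≡⟨ sym (∑-distrib-+ T) ⟩
  ∑ T (λ x → 𝟙 (lookup (x ⊕ d) j) + 𝟙 (lookup x j))
    ≡⟨ ∑-cong T flipped ⟩
  ∑ T (const 1)
    ≡⟨ ∑-length T ⟩
  length T
    ∎
  where
  open ≡-Reasoning
  translated : ∑ T (λ x → 𝟙 (lookup (x ⊕ d) j)) ≡ ∑ T (λ x → 𝟙 (lookup x j))
  translated = K.∑-involution T (_⊕ d) (λ x → 𝟙 (lookup x j)) u (λ x → ⊕-cancelʳ x d)
                              (All.lookup closed)
  flipped : ∀ x → 𝟙 (lookup (x ⊕ d) j) + 𝟙 (lookup x j) ≡ 1
  flipped x rewrite lookup-⊕ x d j | dⱼ with lookup x j
  ... | true  = refl
  ... | false = refl

∈found-if-counted : ∀ (j : Fin n) T → 0 < countPt j T → j ∈found T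
∈found-if-counted j (x ∷ T) pos with j ∈ₛ? x
... | yes j∈x = here j∈x
... | no  _   = there (∈found-if-counted j T pos)

[m+m]/2≡m : ∀ m → (m + m) / 2 ≡ m
[m+m]/2≡m m = trans (cong (_/ 2) (m+m≡m*2 m)) (m*n/n≡m m 2)

halving-coordinate : ∀ (T : List (Subset n)) d → Unique T → 0 < length T → d ≢ ∅ →
                     ClosedUnder T d → Σ (Fin n) λ j → j ∈found T × r j T ≡ vol T / 2
halving-coordinate T d u length>0 d≢∅ closed with ≢∅⇒Nonempty d d≢∅
... | j , j∈d = j , ∈found-if-counted j T countPt>0 , cong (_/ 2) (sym vol≡countPt)
  where
  half : countPt j T + countPt j T ≡ length T
  half = countPt-closed T d j u closed ([]=⇒lookup j∈d)
  vol≡countPt : vol T ≡ countPt j T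
  vol≡countPt = trans (cong (_/ 2) (sym half)) ([m+m]/2≡m (countPt j T))
  countPt>0 : 0 < countPt j T
  countPt>0 = 0<m+m⇒0<m (subst (0 <_) (sym half) length>0)
    where
    0<m+m⇒0<m : ∀ {m} → 0 < m + m → 0 < m
    0<m+m⇒0<m {suc _} _ = s≤s z≤n

-- With n = M + c the bound reads (M − c)² ≤ M.
square-deviation-bound : ∀ M c D → c ≡ M + D ⊎ M ≡ c + D →
                         (M + c) * (M + c) + c ≤ (M + c) + 4 * M * c → D * D ≤ M
square-deviation-bound M c D (inj₁ refl) le =
  +-cancelˡ-≤ (4 * M * M + 4 * M * D + M + D) (D * D) M (subst₂ _≤_ (lhs M D) (rhs M D) le)
  where
  lhs : ∀ M D → (M + (M + D)) * (M + (M + D)) + (M + D) ≡ (4 * M * M + 4 * M * D + M + D) + D * D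
  lhs = solve-∀
  rhs : ∀ M D → (M + (M + D)) + 4 * M * (M + D) ≡ (4 * M * M + 4 * M * D + M + D) + M
  rhs = solve-∀
square-deviation-bound M c D (inj₂ refl) le =
  +-cancelˡ-≤ (4 * c * c + 4 * c * D + c) (D * D) (c + D) (subst₂ _≤_ (lhs c D) (rhs c D) le)
  where
  lhs : ∀ c D → ((c + D) + c) * ((c + D) + c) + c ≡ (4 * c * c + 4 * c * D + c) + D * D
  lhs = solve-∀
  rhs : ∀ c D → ((c + D) + c) + 4 * (c + D) * c ≡ (4 * c * c + 4 * c * D + c) + (c + D)
  rhs = solve-∀

size-shape : ∀ q M E → (q ≡ M + E ⊎ q ≡ M ∸ E) → E + E ≤ M →
             ∃ λ c → q + q ≡ M + c × (c ≡ M + (E + E) ⊎ M ≡ c + (E + E))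
size-shape q M E (inj₁ refl)   _    = M + (E + E) , rearrange M E , inj₁ refl
  where
  rearrange : ∀ M E → (M + E) + (M + E) ≡ M + (M + (E + E))
  rearrange = solve-∀
size-shape q M E (inj₂ q≡M∸E) 2E≤M = c , q+q≡M+c , inj₂ M≡c+2E
  where
  c = M ∸ (E + E)
  M≡c+2E : M ≡ c + (E + E)
  M≡c+2E = sym (m∸n+n≡m 2E≤M)
  q≡c+E : q ≡ c + E
  q≡c+E = begin
    q                ≡⟨ q≡M∸E ⟩
    M ∸ E            ≡⟨ cong (_∸ E) M≡c+2E ⟩
    c + (E + E) ∸ E  ≡⟨ cong (_∸ E) (sym (+-assoc c E E)) ⟩
    c + E + E ∸ E    ≡⟨ m+n∸n≡m (c + E) E ⟩
    c + E            ∎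
    where open ≡-Reasoning
  q+q≡M+c : q + q ≡ M + c
  q+q≡M+c = trans (cong₂ _+_ q≡c+E q≡c+E) (trans (rearrange c E) (cong (_+ c) (sym M≡c+2E)))
    where
    rearrange : ∀ c E → (c + E) + (c + E) ≡ (c + (E + E)) + c
    rearrange = solve-∀

half+half : ∀ N → 2 ∣ N → N / 2 + N / 2 ≡ N
half+half _ (divides q refl) = trans (cong (λ m → m + m) (m*n/n≡m q 2)) (m+m≡m*2 q)

size-decomposition : ∀ t i N → i < t → 2 ∣ N →
  (N / 2 ≡ 2 ^ (t + 1) + 2 ^ i) ⊎ (N / 2 ≡ 2 ^ (t + 1) ∸ 2 ^ i) →
  ∃ λ c → N ≡ 2 ^ suc t + c ×
          (c ≡ 2 ^ suc t + (2 ^ i + 2 ^ i) ⊎ 2 ^ suc t ≡ c + (2 ^ i + 2 ^ i))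
size-decomposition t i N i<t 2∣N vol≡ =
  let c , q+q≡M+c , shape = size-shape (N / 2) M E vol≡M±E 2E≤M
  in  c , trans (sym (half+half N 2∣N)) q+q≡M+c , shape
  where
  M = 2 ^ suc t
  E = 2 ^ i
  vol≡M±E : N / 2 ≡ M + E ⊎ N / 2 ≡ M ∸ E
  vol≡M±E = Sum.map (λ eq → trans eq (cong (λ P → 2 ^ P + E) (+-comm t 1)))
                    (λ eq → trans eq (cong (λ P → 2 ^ P ∸ E) (+-comm t 1))) vol≡
  2E≤M : E + E ≤ M
  2E≤M = subst (_≤ M) (2^-double i) (^-monoʳ-≤ 2 (m≤n⇒m≤1+n i<t))

2^-square-gap : ∀ t i → t ≤ 2 * i → 2 ^ suc t < (2 ^ i + 2 ^ i) * (2 ^ i + 2 ^ i)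
2^-square-gap t i t≤2i = begin-strict
  2 ^ suc t                          <⟨ ^-monoʳ-< 2 (s≤s (s≤s z≤n)) (s≤s t<2i+1) ⟩
  2 ^ (suc i + suc i)                ≡⟨ ^-distribˡ-+-* 2 (suc i) (suc i) ⟩
  2 ^ suc i * 2 ^ suc i              ≡⟨ cong (λ m → m * m) (2^-double i) ⟩
  (2 ^ i + 2 ^ i) * (2 ^ i + 2 ^ i)  ∎
  where
  open ≤-Reasoning
  t<2i+1 : suc t ≤ i + suc i
  t<2i+1 = subst (suc t ≤_) (sym (+-suc i i))
                 (s≤s (subst (t ≤_) (cong (i +_) (+-identityʳ i)) t≤2i))

no-pair-bound : ∀ t i (T : List (Subset n)) → t ≤ 2 * i → i < t → 2 ∣ length T →
                (vol T ≡ 2 ^ (t + 1) + 2 ^ i) ⊎ (vol T ≡ 2 ^ (t + 1) ∸ 2 ^ i) →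
                ¬ PairBound t (t + 3) T
no-pair-bound t i T t≤2i i<t 2∣N vol≡ bound with size-decomposition t i (length T) i<t 2∣N vol≡
... | c , N≡M+c , shape =
  <⇒≱ (2^-square-gap t i t≤2i) (square-deviation-bound M c (E + E) shape bound′)
  where
  M = 2 ^ suc t
  E = 2 ^ i
  2^t+3≡4M : 2 ^ (t + 3) ≡ 4 * M
  2^t+3≡4M = trans (^-distribˡ-+-* 2 t 3) (rearrange (2 ^ t))
    where
    rearrange : ∀ P → P * 8 ≡ 4 * (2 * P)
    rearrange = solve-∀
  bound′ : (M + c) * (M + c) + c ≤ (M + c) + 4 * M * c
  bound′ = subst (λ c′ → (M + c) * (M + c) + c′ ≤ (M + c) + 4 * M * c′) (m+n∸m≡n M c)
                 (subst₂ (λ N P → N * N + (N ∸ M) ≤ N + P * (N ∸ M)) N≡M+c 2^t+3≡4M bound)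

lemma4p5 : (v t i : ℕ) (T : List (Subset v)) →
    IsUnitrade t T →
    HasAfrk T (t + 3) →
    (vol T ≡ 2 ^ (t + 1) + 2 ^ i) ⊎ (vol T ≡ 2 ^ (t + 1) ∸ 2 ^ i) →
    t ≤ 2 * i →
    i < t →
    Σ (Fin v) λ j → j ∈found T × (r j T ≡ vol T / 2)
lemma4p5 v t i T (unique , count-even) (_ , rank≤) vol≡ t≤2i i<t =
  [ (λ (d , d≢∅ , closed) → halving-coordinate T d unique length>0 d≢∅ closed)
  , (λ bound → contradiction bound (no-pair-bound t i T t≤2i i<t (2∣length T even) vol≡))
  ]′ (translation-or-bound t (t + 3) T unique even rank≤)
  where
  even : EvenUpTo t T
  even S size = subst (2 ∣_) (count≡cov S T) (count-even S size)
  length>0 : 0 < length T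
  length>0 with size-decomposition t i (length T) i<t (2∣length T even) vol≡
  ... | c , N≡M+c , _ =
    subst (0 <_) (sym N≡M+c) (<-≤-trans (m^n>0 2 (suc t)) (m≤m+n (2 ^ suc t) c))
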